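{- Let $c_1,c_2$ be integers with $\gcd(c_1,c_2)=1$, and let $f(n)=c_1n+c_2\frac{n(n-1)}2$, so that $\Theta(c_1,c_2)=\{f(n):n\in\mathbb{Z}\}$. Then $\Theta(c_1,c_2)$ is uniformly distributed modulo every power of $2$ if and only if $c_2\not\equiv 2\pmod 4$.
   Context: Here "$\Theta(c_1,c_2)$ is uniformly distributed modulo $2^j$" means that the values $f(n)$ are equidistributed among the residue classes modulo $2^j$: for every residue $r$, $\#\{n\in\mathbb{Z}:|n|\le N,\ f(n)\equiv r\pmod{2^j}\}/(2N+1)\to 2^{ -j}$ as $N\to\infty$. -}

module Defs where

open import Data.Nat as ℕ using (ℕ; _^_; NonZero; _≥_)
open import Data.Nat.Properties using (m^n≢0)
open import Data.Integer as ℤ using (ℤ; +_; _-_)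
open import Data.Integer.DivMod using (_%ℕ_)
open import Data.List using (List; map; upTo; filter; length)
open import Data.Rational as ℚ using (ℚ; _/_; ∣_∣; _<_; 0ℚ)
open import Data.Product using (∃; Σ)
open import Relation.Binary.PropositionalEquality using (_≡_)

-- f(n) = c₁ n + c₂ n(n-1)/2  (n(n-1) is even, so the division is exact)
θ : ℤ → ℤ → ℤ → ℤ
θ c₁ c₂ n = c₁ ℤ.* n ℤ.+ c₂ ℤ.* ((n ℤ.* (n - + 1)) ℤ./ (+ 2))

window : ℕ → List ℤ
window N = map (λ k → + k - + N) (upTo (2 ℕ.* N ℕ.+ 1))

countRes : (ℤ → ℤ) → (m : ℕ) → .{{NonZero m}} → ℤ → ℕ → ℕ
countRes f m r N = length (filter (λ n → (f n %ℕ m) ℕ.≟ (r %ℕ m)) (window N))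

ConvergesTo : (ℕ → ℚ) → ℚ → Set
ConvergesTo a L = ∀ (ε : ℚ) → 0ℚ < ε → ∃ λ N₀ → ∀ N → N ≥ N₀ → ∣ a N ℚ.- L ∣ < ε

UniformMod2^ : (ℤ → ℤ) → ℕ → Set
UniformMod2^ f j = ∀ (r : ℤ) →
  ConvergesTo (λ N → (+ countRes f (2 ^ j) {{m^n≢0 2 j}} r N) / ℕ.suc (2 ℕ.* N))
              (_/_ (+ 1) (2 ^ j) {{m^n≢0 2 j}})

{-# OPTIONS --safe #-}
-- Write f = θ c₁ c₂.  When c₂ ≡ 0 (mod 4) (so c₁ is odd) or c₂ is odd, there is a K ∈ {1, 2}
-- such that f (n + K·2^j) − f n is an odd multiple of 2^j for all n and j.  Pairing n with
-- n + K·2^j shows, by induction on j, that any K·2^j consecutive values of f meet every residue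
-- class mod 2^j exactly K times, so the count over the window [−N, N] stays within a bounded
-- distance of (2N+1)/2^j.  When c₂ ≡ 2 (mod 4), c₁ is odd and f (2u) ≡ 0 (mod 4), so about half
-- of every window falls into the class of 0 mod 4 instead of a quarter.
module Submission where

open import Defs
open import Data.Nat using (ℕ)
open import Data.Integer using (ℤ; +_)
open import Data.Integer.GCD using (gcd)
open import Data.Integer.DivMod using (_%ℕ_)
open import Relation.Binary.PropositionalEquality
open import Data.Product using (_×_; _,_)

module Sums where
  open import Data.Nat
  open import Data.Nat.Properties
  open import Data.List using (applyUpTo; filter; length)
  open import Function using (_∘_)
  open import Relation.Nullary using (Dec; yes; no)
  open import Relation.Unary using (Decidable)
  open import Algebra.Properties.CommutativeSemigroup +-commutativeSemigroup using (interchange)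

  ∑ : ℕ → (ℕ → ℕ) → ℕ
  ∑ zero    g = 0
  ∑ (suc n) g = g 0 + ∑ n (g ∘ suc)

  syntax ∑ n (λ k → e) = ∑[ k < n ] e

  𝟙 : ∀ {A : Set} → Dec A → ℕ
  𝟙 (yes _) = 1
  𝟙 (no _)  = 0

  ∑-cong : ∀ {g h} n → (∀ k → g k ≡ h k) → ∑ n g ≡ ∑ n h
  ∑-cong zero    g≡h = refl
  ∑-cong (suc n) g≡h = cong₂ _+_ (g≡h 0) (∑-cong n (g≡h ∘ suc))

  ∑-const : ∀ n c → ∑[ k < n ] c ≡ n * c
  ∑-const zero    c = refl
  ∑-const (suc n) c = cong (_+_ c) (∑-const n c)

  ∑-split : ∀ m n g → ∑ (m + n) g ≡ ∑ m g + ∑[ k < n ] g (m + k)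
  ∑-split zero    n g = refl
  ∑-split (suc m) n g = begin
    g 0 + ∑ (m + n) (g ∘ suc)                           ≡⟨ cong (_+_ (g 0)) (∑-split m n (g ∘ suc)) ⟩
    g 0 + (∑ m (g ∘ suc) + ∑[ k < n ] g (suc m + k))     ≡⟨ +-assoc (g 0) _ _ ⟨
    g 0 + ∑ m (g ∘ suc) + ∑[ k < n ] g (suc m + k)       ∎
    where open ≡-Reasoning

  ∑-distrib-+ : ∀ n g h → ∑[ k < n ] (g k + h k) ≡ ∑ n g + ∑ n h
  ∑-distrib-+ zero    g h = refl
  ∑-distrib-+ (suc n) g h = trans (cong (_+_ (g 0 + h 0)) (∑-distrib-+ n (g ∘ suc) (h ∘ suc))) (interchange (g 0) (h 0) _ _)

  ∑-mono-≤ : ∀ n {g h} → (∀ k → g k ≤ h k) → ∑ n g ≤ ∑ n h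
  ∑-mono-≤ zero    g≤h = z≤n
  ∑-mono-≤ (suc n) g≤h = +-mono-≤ (g≤h 0) (∑-mono-≤ n (g≤h ∘ suc))

  ∑-pairs-≥ : ∀ n g → (∀ k → 1 ≤ g k + g (suc k)) → n ≤ ∑ (n + n) g
  ∑-pairs-≥ zero    g pair = z≤n
  ∑-pairs-≥ (suc n) g pair rewrite +-suc n n = begin
    1 + n                                   ≤⟨ +-mono-≤ (pair 0) (∑-pairs-≥ n (g ∘ suc ∘ suc) (pair ∘ suc ∘ suc)) ⟩
    g 0 + g 1 + ∑ (n + n) (g ∘ suc ∘ suc)   ≡⟨ +-assoc (g 0) (g 1) _ ⟩
    g 0 + (g 1 + ∑ (n + n) (g ∘ suc ∘ suc)) ∎
    where open ≤-Reasoning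

  length-filter-applyUpTo : ∀ {A : Set} {P : A → Set} (P? : Decidable P) (f : ℕ → A) n →
    length (filter P? (applyUpTo f n)) ≡ ∑[ k < n ] 𝟙 (P? (f k))
  length-filter-applyUpTo P? f zero = refl
  length-filter-applyUpTo P? f (suc n) with P? (f 0)
  ... | yes _ = cong suc (length-filter-applyUpTo P? (f ∘ suc) n)
  ... | no  _ = length-filter-applyUpTo P? (f ∘ suc) n

module Congruence where
  open import Data.Nat as ℕ using (zero; suc; NonZero)
  import Data.Nat.Properties as ℕ
  import Data.Nat.Divisibility as ℕ
  open import Data.Integer using (+_; _+_; _-_; _*_; ∣_∣; _%ℕ_; _/ℕ_)
  open import Data.Integer.Properties
  open import Data.Integer.DivMod using (a≡a%ℕn+[a/ℕn]*n; n%ℕd<d)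
  open import Data.Integer.Divisibility.Signed
  import Data.Integer.Divisibility as Unsigned
  open import Data.Integer.GCD using (gcd; gcd-greatest)
  open import Data.Integer.Tactic.RingSolver using (solve-∀)
  open import Data.Product using (∃-syntax; _,_)
  open import Data.Sum using (_⊎_; inj₁; inj₂)
  open import Relation.Nullary using (¬_; contradiction)

  residue-unique : ∀ {m a b} → a ℕ.< m → b ℕ.< m → + m ∣ + a - + b → a ≡ b
  residue-unique {m} {a} {b} a<m b<m m∣a-b = +-injective (i-j≡0⇒i≡j (+ a) (+ b) (∣i∣≡0⇒i≡0 ∣a-b∣≡0))
    where
    ∣a-b∣<m : ∣ + a - + b ∣ ℕ.< m
    ∣a-b∣<m = subst (ℕ._< m) (cong ∣_∣ (sym (m-n≡m⊖n a b)))
                (ℕ.≤-<-trans (∣m⊝n∣≤m⊔n a b) (ℕ.⊔-pres-<m a<m b<m))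
    ∣a-b∣≡0 : ∣ + a - + b ∣ ≡ 0
    ∣a-b∣≡0 with ∣ + a - + b ∣ | ∣a-b∣<m | ∣⇒∣ᵤ m∣a-b
    ... | zero  | _   | _   = refl
    ... | suc _ | d<m | m∣d = contradiction m∣d (ℕ.>⇒∤ d<m)

  %ℕ-≡⇒∣ : ∀ m .{{_ : NonZero m}} x y → x %ℕ m ≡ y %ℕ m → + m ∣ x - y
  %ℕ-≡⇒∣ m x y rx≡ry = divides (qx - qy) (begin
    x - y                                  ≡⟨ cong₂ _-_ (a≡a%ℕn+[a/ℕn]*n x m) (a≡a%ℕn+[a/ℕn]*n y m) ⟩
    (+ rx + qx * + m) - (+ ry + qy * + m)  ≡⟨ cong (λ ρ → (+ ρ + qx * + m) - (+ ry + qy * + m)) rx≡ry ⟩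
    (+ ry + qx * + m) - (+ ry + qy * + m)  ≡⟨ cancel (+ ry) qx qy (+ m) ⟩
    (qx - qy) * + m                        ∎)
    where
    open ≡-Reasoning
    rx = x %ℕ m
    ry = y %ℕ m
    qx = x /ℕ m
    qy = y /ℕ m
    cancel : ∀ ρ p q M → (ρ + p * M) - (ρ + q * M) ≡ (p - q) * M
    cancel = solve-∀

  ∣⇒%ℕ-≡ : ∀ m .{{_ : NonZero m}} x y → + m ∣ x - y → x %ℕ m ≡ y %ℕ m
  ∣⇒%ℕ-≡ m x y m∣x-y = residue-unique (n%ℕd<d x m) (n%ℕd<d y m)
    (subst (+ m ∣_) (sym remainders) (∣m∣n⇒∣m-n m∣x-y (∣n⇒∣m*n (qx - qy) ∣-refl)))
    where
    open ≡-Reasoning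
    rx = x %ℕ m
    ry = y %ℕ m
    qx = x /ℕ m
    qy = y /ℕ m
    cancel : ∀ ρ σ p q M → ((ρ + p * M) - (σ + q * M)) - (p - q) * M ≡ ρ - σ
    cancel = solve-∀
    remainders : + rx - + ry ≡ (x - y) - (qx - qy) * + m
    remainders = begin
      + rx - + ry                                             ≡⟨ cancel (+ rx) (+ ry) qx qy (+ m) ⟨
      ((+ rx + qx * + m) - (+ ry + qy * + m)) - (qx - qy) * + m ≡⟨ cong₂ (λ x′ y′ → (x′ - y′) - (qx - qy) * + m)
                                                                     (a≡a%ℕn+[a/ℕn]*n x m) (a≡a%ℕn+[a/ℕn]*n y m) ⟨
      (x - y) - (qx - qy) * + m                               ∎

  parity : ∀ k → ∃[ u ] (k ≡ + 2 * u ⊎ k ≡ + 1 + + 2 * u)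
  parity k with k %ℕ 2 | n%ℕd<d k 2 | a≡a%ℕn+[a/ℕn]*n k 2
  ... | 0 | _ | k≡ = k /ℕ 2 , inj₁ (trans k≡ (trans (+-identityˡ (k /ℕ 2 * + 2)) (*-comm (k /ℕ 2) (+ 2))))
  ... | 1 | _ | k≡ = k /ℕ 2 , inj₂ (trans k≡ (cong (_+_ (+ 1)) (*-comm (k /ℕ 2) (+ 2))))
  ... | suc (suc _) | ℕ.s≤s (ℕ.s≤s ()) | _

  2∤1 : ¬ (+ 2 ∣ + 1)
  2∤1 2∣1 with ℕ.∣⇒≤ (∣⇒∣ᵤ 2∣1)
  ... | ℕ.s≤s ()

  odd≢even : ∀ t k → + 1 + + 2 * t ≢ + 2 * k
  odd≢even t k odd≡even = 2∤1 (divides (k - t) (begin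
    + 1                           ≡⟨ add-sub t ⟩
    (+ 1 + + 2 * t) - + 2 * t     ≡⟨ cong (_- + 2 * t) odd≡even ⟩
    + 2 * k - + 2 * t             ≡⟨ factor k t ⟩
    (k - t) * + 2                 ∎))
    where
    open ≡-Reasoning
    add-sub : ∀ t → + 1 ≡ (+ 1 + + 2 * t) - + 2 * t
    add-sub = solve-∀
    factor : ∀ k t → + 2 * k - + 2 * t ≡ (k - t) * + 2
    factor = solve-∀

  2m∤odd*m : ∀ m .{{_ : NonZero m}} t → ¬ (+ (2 ℕ.* m) ∣ (+ 1 + + 2 * t) * + m)
  2m∤odd*m m t (divides k eq) = odd≢even t k (*-cancelʳ-≡ _ _ (+ m) (begin
    (+ 1 + + 2 * t) * + m    ≡⟨ eq ⟩
    k * + (2 ℕ.* m)          ≡⟨ cong (k *_) (pos-* 2 m) ⟩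
    k * (+ 2 * + m)          ≡⟨ reassoc k (+ m) ⟩
    + 2 * k * + m            ∎))
    where
    open ≡-Reasoning
    reassoc : ∀ k m → k * (+ 2 * m) ≡ + 2 * k * m
    reassoc = solve-∀

  gcd≡1∧2∣c₂⇒c₁-odd : ∀ c₁ c₂ → gcd c₁ c₂ ≡ + 1 → + 2 ∣ c₂ → ∃[ a ] c₁ ≡ + 1 + + 2 * a
  gcd≡1∧2∣c₂⇒c₁-odd c₁ c₂ gcd≡1 2∣c₂ with parity c₁
  ... | a , inj₂ c₁≡1+2a = a , c₁≡1+2a
  ... | u , inj₁ c₁≡2u   = contradiction (∣ᵤ⇒∣ (subst (+ 2 Unsigned.∣_) gcd≡1 2∣gcd)) 2∤1
    where
    2∣c₁ : + 2 ∣ c₁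
    2∣c₁ = divides u (trans c₁≡2u (*-comm (+ 2) u))
    2∣gcd : + 2 Unsigned.∣ gcd c₁ c₂
    2∣gcd = gcd-greatest {c₁} {c₂} {+ 2} (∣⇒∣ᵤ 2∣c₁) (∣⇒∣ᵤ 2∣c₂)

  c%ℕ4≢2⇒c≡4k⊎c≡1+2b : ∀ c → c %ℕ 4 ≢ 2 → (∃[ k ] c ≡ + 4 * k) ⊎ (∃[ b ] c ≡ + 1 + + 2 * b)
  c%ℕ4≢2⇒c≡4k⊎c≡1+2b c c≢2 with c %ℕ 4 | n%ℕd<d c 4 | a≡a%ℕn+[a/ℕn]*n c 4
  ... | 0 | _ | c≡ = inj₁ (c /ℕ 4 , trans c≡ (rem0 (c /ℕ 4)))
    where
    rem0 : ∀ q → + 0 + q * + 4 ≡ + 4 * q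
    rem0 = solve-∀
  ... | 1 | _ | c≡ = inj₂ (c /ℕ 4 * + 2 , trans c≡ (rem1 (c /ℕ 4)))
    where
    rem1 : ∀ q → + 1 + q * + 4 ≡ + 1 + + 2 * (q * + 2)
    rem1 = solve-∀
  ... | 2 | _ | _  = contradiction refl c≢2
  ... | 3 | _ | c≡ = inj₂ (+ 1 + c /ℕ 4 * + 2 , trans c≡ (rem3 (c /ℕ 4)))
    where
    rem3 : ∀ q → + 3 + q * + 4 ≡ + 1 + + 2 * (+ 1 + q * + 2)
    rem3 = solve-∀
  ... | suc (suc (suc (suc _))) | ℕ.s≤s (ℕ.s≤s (ℕ.s≤s (ℕ.s≤s ()))) | _

  c%ℕ4≡2⇒c≡2+4q : ∀ c → c %ℕ 4 ≡ 2 → ∃[ q ] c ≡ + 2 + + 4 * q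
  c%ℕ4≡2⇒c≡2+4q c c≡2 = c /ℕ 4 ,
    trans (a≡a%ℕn+[a/ℕn]*n c 4) (trans (cong (λ ρ → + ρ + c /ℕ 4 * + 4) c≡2) (rem2 (c /ℕ 4)))
    where
    rem2 : ∀ q → + 2 + q * + 4 ≡ + 2 + + 4 * q
    rem2 = solve-∀

open Sums
open Congruence

module Counting where
  open import Data.Nat as ℕ using (ℕ; zero; suc; NonZero; _^_)
  import Data.Nat.Properties as ℕ
  open import Data.Integer using (ℤ; +_; _+_; _-_; _*_; _%ℕ_)
  open import Data.Integer.Properties using (pos-+; pos-*; *-identityʳ; *-distribʳ-+)
  open import Data.Integer.Divisibility.Signed
  open import Data.Integer.Tactic.RingSolver using (solve-∀)
  import Data.Nat.Tactic.RingSolver as ℕ-Solver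
  open import Data.List using (upTo; applyUpTo; map; filter; length)
  open import Data.List.Properties using (map-applyUpTo)
  open import Data.Product using (∃-syntax; _,_)
  open import Data.Sum using (_⊎_; inj₁; inj₂)
  open import Function using (_∘_; id)
  open import Relation.Nullary using (¬_; Dec; yes; no; contradiction)

  hit : (m : ℕ) .{{_ : NonZero m}} → ℤ → ℤ → ℕ
  hit m r x = 𝟙 (x %ℕ m ℕ.≟ r %ℕ m)

  hit≡1 : ∀ m .{{_ : NonZero m}} r x → + m ∣ x - r → hit m r x ≡ 1
  hit≡1 m r x m∣x-r with x %ℕ m ℕ.≟ r %ℕ m
  ... | yes _   = refl
  ... | no  x≢r = contradiction (∣⇒%ℕ-≡ m x r m∣x-r) x≢r

  hit≡0 : ∀ m .{{_ : NonZero m}} r x → ¬ (+ m ∣ x - r) → hit m r x ≡ 0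
  hit≡0 m r x m∤x-r with x %ℕ m ℕ.≟ r %ℕ m
  ... | yes x≡r = contradiction (%ℕ-≡⇒∣ m x r x≡r) m∤x-r
  ... | no  _   = refl

  hit≤1 : ∀ m .{{_ : NonZero m}} r x → hit m r x ℕ.≤ 1
  hit≤1 m r x with x %ℕ m ℕ.≟ r %ℕ m
  ... | yes _ = ℕ.≤-refl
  ... | no  _ = ℕ.z≤n

  countRes≡∑ : ∀ f m .{{_ : NonZero m}} r N →
    countRes f m r N ≡ ∑[ k < suc (2 ℕ.* N) ] hit m r (f (+ k - + N))
  countRes≡∑ f m r N = begin
    length (filter P? (map (λ k → + k - + N) (upTo L)))      ≡⟨ cong (length ∘ filter P?) (map-applyUpTo id (λ k → + k - + N) L) ⟩
    length (filter P? (applyUpTo (λ k → + k - + N) L))       ≡⟨ length-filter-applyUpTo P? (λ k → + k - + N) L ⟩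
    ∑[ k < L ] hit m r (f (+ k - + N))                       ≡⟨ cong (λ L → ∑[ k < L ] hit m r (f (+ k - + N))) (ℕ.+-comm (2 ℕ.* N) 1) ⟩
    ∑[ k < suc (2 ℕ.* N) ] hit m r (f (+ k - + N))           ∎
    where
    open ≡-Reasoning
    L = 2 ℕ.* N ℕ.+ 1
    P? = λ n → f n %ℕ m ℕ.≟ r %ℕ m

  hit-1≡1 : ∀ r x → hit 1 r x ≡ 1
  hit-1≡1 r x = hit≡1 1 r x (divides (x - r) (sym (*-identityʳ (x - r))))

  Balanced : (ℤ → ℤ) → (m : ℕ) .{{_ : NonZero m}} → ℕ → ℕ → Set
  Balanced f m P K = ∀ r a → ∑[ k < P ] hit m r (f (a + + k)) ≡ K

  module _ (m : ℕ) .{{_ : NonZero m}} where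
    private instance
      2m≢0 : NonZero (2 ℕ.* m)
      2m≢0 = ℕ.m*n≢0 2 m

    -- With x − r = k·m, the parity of k decides which of x and x + odd·m is ≡ r (mod 2m).
    hit-split : ∀ r x t → hit (2 ℕ.* m) r x ℕ.+ hit (2 ℕ.* m) r (x + (+ 1 + + 2 * t) * + m) ≡ hit m r x
    hit-split r x t = by-cases (+ m ∣? x - r)
      where
      open ≡-Reasoning
      2m = 2 ℕ.* m
      odd = + 1 + + 2 * t
      y = x + odd * + m

      m∣_ : ∀ {z} → + 2m ∣ z → + m ∣ z
      m∣_ = ∣-trans (divides (+ 2) (pos-* 2 m))

      twice : ∀ v → + 2 * v * + m ≡ v * + 2m
      twice v = trans (reassoc v (+ m)) (cong (v *_) (sym (pos-* 2 m)))
        where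
        reassoc : ∀ v m → + 2 * v * m ≡ v * (+ 2 * m)
        reassoc = solve-∀

      y-r≡ : ∀ {k} → x - r ≡ k * + m → y - r ≡ (k + odd) * + m
      y-r≡ {k} x-r≡km = begin
        x + odd * + m - r       ≡⟨ shuffle x r odd (+ m) ⟩
        (x - r) + odd * + m     ≡⟨ cong (_+ odd * + m) x-r≡km ⟩
        k * + m + odd * + m     ≡⟨ *-distribʳ-+ (+ m) k odd ⟨
        (k + odd) * + m         ∎
        where
        shuffle : ∀ x r o m → x + o * m - r ≡ (x - r) + o * m
        shuffle = solve-∀

      by-cases : Dec (+ m ∣ x - r) → hit 2m r x ℕ.+ hit 2m r y ≡ hit m r x
      by-cases (no m∤x-r) = begin
        hit 2m r x ℕ.+ hit 2m r y   ≡⟨ cong₂ ℕ._+_ (hit≡0 2m r x (m∤x-r ∘ m∣_)) (hit≡0 2m r y (m∤x-r ∘ m∣x-r)) ⟩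
        0                           ≡⟨ hit≡0 m r x m∤x-r ⟨
        hit m r x                   ∎
        where
        m∣x-r : + 2m ∣ y - r → + m ∣ x - r
        m∣x-r 2m∣y-r = subst (+ m ∣_) (x-r≡ x r odd (+ m))
          (∣m∣n⇒∣m-n (m∣_ 2m∣y-r) (∣n⇒∣m*n odd ∣-refl))
          where
          x-r≡ : ∀ x r o m → (x + o * m) - r - o * m ≡ x - r
          x-r≡ = solve-∀
      by-cases (yes m∣x-r@(divides k x-r≡km)) = trans (by-parity (parity k)) (sym (hit≡1 m r x m∣x-r))
        where
        by-parity : ∃[ u ] (k ≡ + 2 * u ⊎ k ≡ + 1 + + 2 * u) → hit 2m r x ℕ.+ hit 2m r y ≡ 1
        by-parity (u , inj₁ k≡2u) = cong₂ ℕ._+_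
          (hit≡1 2m r x (divides u (trans x-r≡km (trans (cong (_* + m) k≡2u) (twice u)))))
          (hit≡0 2m r y (2m∤odd*m m (u + t) ∘ subst (+ 2m ∣_) y-r≡odd))
          where
          y-r≡odd : y - r ≡ (+ 1 + + 2 * (u + t)) * + m
          y-r≡odd = trans (y-r≡ {k} x-r≡km) (cong (_* + m) (trans (cong (_+ odd) k≡2u) (even+odd u t)))
            where
            even+odd : ∀ u t → + 2 * u + (+ 1 + + 2 * t) ≡ + 1 + + 2 * (u + t)
            even+odd = solve-∀
        by-parity (u , inj₂ k≡1+2u) = cong₂ ℕ._+_
          (hit≡0 2m r x (2m∤odd*m m u ∘ subst (+ 2m ∣_) (trans x-r≡km (cong (_* + m) k≡1+2u))))
          (hit≡1 2m r y (divides (u + t + + 1)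
            (trans (y-r≡ {k} x-r≡km) (trans (cong (_* + m) odd+odd) (twice (u + t + + 1))))))
          where
          odd+odd : k + odd ≡ + 2 * (u + t + + 1)
          odd+odd = trans (cong (_+ odd) k≡1+2u) (sum-of-odds u t)
            where
            sum-of-odds : ∀ u t → (+ 1 + + 2 * u) + (+ 1 + + 2 * t) ≡ + 2 * (u + t + + 1)
            sum-of-odds = solve-∀

    balanced-double : ∀ f P K → (∀ n → ∃[ t ] f (n + + P) ≡ f n + (+ 1 + + 2 * t) * + m) →
      Balanced f m P K → Balanced f (2 ℕ.* m) (P ℕ.+ P) K
    balanced-double f P K shift balanced r a = begin
      ∑ (P ℕ.+ P) G                                ≡⟨ ∑-split P P G ⟩
      ∑ P G ℕ.+ ∑[ k < P ] G (P ℕ.+ k)             ≡⟨ ∑-distrib-+ P G (λ k → G (P ℕ.+ k)) ⟨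
      ∑[ k < P ] (G k ℕ.+ G (P ℕ.+ k))             ≡⟨ ∑-cong P pair ⟩
      ∑[ k < P ] hit m r (f (a + + k))             ≡⟨ balanced r a ⟩
      K                                            ∎
      where
      open ≡-Reasoning
      G : ℕ → ℕ
      G k = hit (2 ℕ.* m) r (f (a + + k))
      a+[P+k]≡[a+k]+P : ∀ k → a + + (P ℕ.+ k) ≡ (a + + k) + + P
      a+[P+k]≡[a+k]+P k = trans (cong (_+_ a) (pos-+ P k)) (shuffle a (+ P) (+ k))
        where
        shuffle : ∀ a p k → a + (p + k) ≡ (a + k) + p
        shuffle = solve-∀
      pair : ∀ k → G k ℕ.+ G (P ℕ.+ k) ≡ hit m r (f (a + + k))
      pair k = let t , f-shift = shift (a + + k) in begin
        G k ℕ.+ G (P ℕ.+ k)                                             ≡⟨ cong (λ z → G k ℕ.+ hit (2 ℕ.* m) r z) (cong f (a+[P+k]≡[a+k]+P k)) ⟩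
        G k ℕ.+ hit (2 ℕ.* m) r (f ((a + + k) + + P))                    ≡⟨ cong (λ z → G k ℕ.+ hit (2 ℕ.* m) r z) f-shift ⟩
        G k ℕ.+ hit (2 ℕ.* m) r (f (a + + k) + (+ 1 + + 2 * t) * + m)    ≡⟨ hit-split r (f (a + + k)) t ⟩
        hit m r (f (a + + k))                                           ∎

  shifts⇒balanced : ∀ f K →
    (∀ j n → ∃[ t ] f (n + + (K ℕ.* 2 ^ j)) ≡ f n + (+ 1 + + 2 * t) * + (2 ^ j)) →
    ∀ j → Balanced f (2 ^ j) {{ℕ.m^n≢0 2 j}} (K ℕ.* 2 ^ j) K
  shifts⇒balanced f K shift zero r a = begin
    ∑[ k < K ℕ.* 1 ] hit 1 r (f (a + + k))   ≡⟨ ∑-cong (K ℕ.* 1) (λ k → hit-1≡1 r (f (a + + k))) ⟩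
    ∑[ k < K ℕ.* 1 ] 1                       ≡⟨ ∑-const (K ℕ.* 1) 1 ⟩
    K ℕ.* 1 ℕ.* 1                            ≡⟨ trans (ℕ.*-identityʳ (K ℕ.* 1)) (ℕ.*-identityʳ K) ⟩
    K                                        ∎
    where open ≡-Reasoning
  shifts⇒balanced f K shift (suc j) =
    subst (λ P → Balanced f (2 ^ suc j) {{ℕ.m^n≢0 2 (suc j)}} P K) (sym (double K (2 ^ j)))
    (balanced-double (2 ^ j) {{ℕ.m^n≢0 2 j}} f (K ℕ.* 2 ^ j) K (shift j) (shifts⇒balanced f K shift j))
    where
    double : ∀ K p → K ℕ.* (2 ℕ.* p) ≡ K ℕ.* p ℕ.+ K ℕ.* p
    double = ℕ-Solver.solve-∀

open Counting

module Discrepancy where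
  open import Data.Nat
  open import Data.Nat.Properties
  open import Data.Nat.DivMod using (m≡m%n+[m/n]*n; m%n<n)
  open import Data.Integer using (_⊖_; ∣_∣)
  open import Data.Integer.Properties using (∣m⊝n∣≤m⊔n; +-cancelˡ-⊖)
  open import Function using (_∘_)

  discrepancy-≤-remainder : ∀ {P K M} .{{_ : NonZero M}} g → (∀ k → g k ≤ 1) →
    (∀ a → ∑[ k < P ] g (a + k) ≡ K) → P ≡ K * M →
    ∀ q s → ∣ ∑ (q * P + s) g * M ⊖ (q * P + s) ∣ ≤ s * M
  discrepancy-≤-remainder {M = M} g g≤1 blocks P≡KM zero s = ≤-trans (∣m⊝n∣≤m⊔n _ s) (⊔-lub ∑g*M≤s*M (m≤m*n s M))
    where
    ∑g*M≤s*M : ∑ s g * M ≤ s * M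
    ∑g*M≤s*M = *-monoˡ-≤ M (≤-trans (∑-mono-≤ s g≤1) (≤-reflexive (trans (∑-const s 1) (*-identityʳ s))))
  discrepancy-≤-remainder {P} {K} {M} g g≤1 blocks P≡KM (suc q) s = begin
    ∣ ∑ (P + q * P + s) g * M ⊖ (P + q * P + s) ∣       ≡⟨ cong ∣_∣ (cong₂ _⊖_ counts (+-assoc P (q * P) s)) ⟩
    ∣ (P + ∑ (q * P + s) g′ * M) ⊖ (P + (q * P + s)) ∣  ≡⟨ cong ∣_∣ (+-cancelˡ-⊖ P _ _) ⟩
    ∣ ∑ (q * P + s) g′ * M ⊖ (q * P + s) ∣              ≤⟨ discrepancy-≤-remainder g′ (g≤1 ∘ _+_ P) blocks′ P≡KM q s ⟩
    s * M                                                ∎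
    where
    open ≤-Reasoning
    g′ : ℕ → ℕ
    g′ k = g (P + k)
    blocks′ : ∀ a → ∑[ k < P ] g′ (a + k) ≡ K
    blocks′ a = trans (∑-cong P (λ k → cong g (sym (+-assoc P a k)))) (blocks (P + a))
    counts : ∑ (P + q * P + s) g * M ≡ P + ∑ (q * P + s) g′ * M
    counts = begin-equality
      ∑ (P + q * P + s) g * M              ≡⟨ cong (λ n → ∑ n g * M) (+-assoc P (q * P) s) ⟩
      ∑ (P + (q * P + s)) g * M            ≡⟨ cong (_* M) (∑-split P (q * P + s) g) ⟩
      (∑ P g + ∑ (q * P + s) g′) * M       ≡⟨ cong (λ n → (n + ∑ (q * P + s) g′) * M) (blocks 0) ⟩
      (K + ∑ (q * P + s) g′) * M           ≡⟨ *-distribʳ-+ M K _ ⟩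
      K * M + ∑ (q * P + s) g′ * M         ≡⟨ cong (_+ ∑ (q * P + s) g′ * M) P≡KM ⟨
      P + ∑ (q * P + s) g′ * M             ∎

  discrepancy-≤-period : ∀ {P K M} .{{_ : NonZero M}} .{{_ : NonZero P}} g → (∀ k → g k ≤ 1) →
    (∀ a → ∑[ k < P ] g (a + k) ≡ K) → P ≡ K * M →
    ∀ L → ∣ ∑ L g * M ⊖ L ∣ ≤ P * M
  discrepancy-≤-period {P} {M = M} g g≤1 blocks P≡KM L = begin
    ∣ ∑ L g * M ⊖ L ∣                                    ≡⟨ cong (λ n → ∣ ∑ n g * M ⊖ n ∣) L≡qP+s ⟩
    ∣ ∑ (L / P * P + L % P) g * M ⊖ (L / P * P + L % P) ∣ ≤⟨ discrepancy-≤-remainder g g≤1 blocks P≡KM (L / P) (L % P) ⟩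
    L % P * M                                            ≤⟨ *-monoˡ-≤ M (<⇒≤ (m%n<n L P)) ⟩
    P * M                                                ∎
    where
    open ≤-Reasoning
    L≡qP+s : L ≡ L / P * P + L % P
    L≡qP+s = trans (m≡m%n+[m/n]*n L P) (+-comm (L % P) _)

open Discrepancy

module Density where
  open import Data.Nat as ℕ using (ℕ; suc; NonZero; _≤_; _<_)
  import Data.Nat.Properties as ℕ
  open import Data.Nat.Coprimality using (Coprime)
  open import Data.Integer as ℤ using (ℤ; +_; +[1+_]; -[1+_]; _⊖_)
  import Data.Integer.Properties as ℤ
  open import Data.Rational as ℚ using (mkℚ; _/_; toℚᵘ)
  import Data.Rational.Properties as ℚ
  open import Data.Rational.Unnormalised as ℚᵘ using (mkℚᵘ; *<*)
  import Data.Rational.Unnormalised.Properties as ℚᵘ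
  open import Data.Product using (_×_; _,_; proj₁; proj₂)
  open import Function using (_⇔_; mk⇔; Equivalence)

  ∣c/L-1/M∣<ε⇔ : ∀ c l M .{{_ : NonZero M}} a d .(cop : Coprime (suc a) (suc d)) →
    ℚ.∣ + c / suc l ℚ.- + 1 / M ∣ ℚ.< mkℚ +[1+ a ] d cop ⇔
    ℤ.∣ c ℕ.* M ⊖ suc l ∣ ℕ.* suc d < suc a ℕ.* (suc l ℕ.* M)
  ∣c/L-1/M∣<ε⇔ c l M@(suc m) a d cop = mk⇔ to from
    where
    ε = mkℚ +[1+ a ] d cop
    D = ℤ.∣ c ℕ.* M ⊖ suc l ∣
    distance : toℚᵘ ℚ.∣ + c / suc l ℚ.- + 1 / M ∣ ℚᵘ.≃ ℚᵘ.∣ mkℚᵘ (+ c) l ℚᵘ.- mkℚᵘ (+ 1) m ∣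
    distance = ℚᵘ.≃-trans (ℚ.toℚᵘ-homo-∣-∣ _) (ℚᵘ.∣-∣-cong
      (ℚᵘ.≃-trans (ℚ.toℚᵘ-homo-+ (+ c / suc l) (ℚ.- (+ 1 / M)))
        (ℚᵘ.+-cong (ℚ.toℚᵘ-fromℚᵘ (mkℚᵘ (+ c) l))
          (ℚᵘ.≃-trans (ℚ.toℚᵘ-homo‿- (+ 1 / M)) (ℚᵘ.-‿cong (ℚ.toℚᵘ-fromℚᵘ (mkℚᵘ (+ 1) m)))))))
    numerator : ℤ.∣ + c ℤ.* + M ℤ.+ ℤ.- + 1 ℤ.* + suc l ∣ ≡ ℤ.∣ c ℕ.* M ⊖ suc l ∣
    numerator = cong ℤ.∣_∣ (trans (cong₂ ℤ._+_ (sym (ℤ.pos-* c M)) (ℤ.-1*i≡-i (+ suc l))) (ℤ.m-n≡m⊖n (c ℕ.* M) (suc l)))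
    cross-multiplied : + D ℤ.* + suc d ≡ + (D ℕ.* suc d) × +[1+ a ] ℤ.* + (suc l ℕ.* M) ≡ + (suc a ℕ.* (suc l ℕ.* M))
    cross-multiplied = sym (ℤ.pos-* D (suc d)) , sym (ℤ.pos-* (suc a) (suc l ℕ.* M))
    to : ℚ.∣ + c / suc l ℚ.- + 1 / M ∣ ℚ.< ε → D ℕ.* suc d < suc a ℕ.* (suc l ℕ.* M)
    to dist<ε with ℚᵘ.<-respˡ-≃ distance (ℚ.toℚᵘ-mono-< dist<ε)
    ... | *<* num<den = ℤ.drop‿+<+ (subst₂ ℤ._<_
      (trans (cong (λ n → + n ℤ.* + suc d) numerator) (proj₁ cross-multiplied)) (proj₂ cross-multiplied) num<den)
    from : D ℕ.* suc d < suc a ℕ.* (suc l ℕ.* M) → ℚ.∣ + c / suc l ℚ.- + 1 / M ∣ ℚ.< ε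
    from D<den = ℚ.toℚᵘ-cancel-< (ℚᵘ.<-respˡ-≃ (ℚᵘ.≃-sym distance) (*<* (subst₂ ℤ._<_
      (trans (sym (proj₁ cross-multiplied)) (cong (λ n → + n ℤ.* + suc d) (sym numerator)))
      (sym (proj₂ cross-multiplied)) (ℤ.+<+ D<den))))

  bounded-discrepancy⇒converges : ∀ (c : ℕ → ℕ) M .{{_ : NonZero M}} B →
    (∀ N → ℤ.∣ c N ℕ.* M ⊖ suc (2 ℕ.* N) ∣ ≤ B) →
    ConvergesTo (λ N → + c N / suc (2 ℕ.* N)) (+ 1 / M)
  bounded-discrepancy⇒converges c M B bound (mkℚ (+ 0) _ _) (ℚ.*<* (ℤ.+<+ ()))
  bounded-discrepancy⇒converges c M B bound (mkℚ -[1+ _ ] _ _) (ℚ.*<* ())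
  bounded-discrepancy⇒converges c M B bound (mkℚ +[1+ a ] d cop) _ = B ℕ.* suc d , close
    where
    open ℕ.≤-Reasoning
    close : ∀ N → N ℕ.≥ B ℕ.* suc d → ℚ.∣ + c N / suc (2 ℕ.* N) ℚ.- + 1 / M ∣ ℚ.< mkℚ +[1+ a ] d cop
    close N N≥ = Equivalence.from (∣c/L-1/M∣<ε⇔ (c N) (2 ℕ.* N) M a d cop) (begin-strict
      ℤ.∣ c N ℕ.* M ⊖ L ∣ ℕ.* suc d   ≤⟨ ℕ.*-monoˡ-≤ (suc d) (bound N) ⟩
      B ℕ.* suc d                     ≤⟨ N≥ ⟩
      N                               <⟨ ℕ.s≤s (ℕ.m≤m+n N (N ℕ.+ 0)) ⟩
      L                               ≤⟨ ℕ.m≤m*n L M ⟩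
      L ℕ.* M                         ≤⟨ ℕ.m≤m+n (L ℕ.* M) _ ⟩
      suc a ℕ.* (L ℕ.* M)             ∎)
      where
      L = suc (2 ℕ.* N)

open Density

module Equidistribution where
  open import Data.Nat as ℕ using (ℕ; suc; NonZero; _^_; _≤_)
  import Data.Nat.Properties as ℕ
  open import Data.Integer using (+_; _+_; _-_; _*_; _⊖_; ∣_∣)
  open import Data.Integer.Properties using (pos-+)
  open import Data.Integer.Tactic.RingSolver using (solve-∀)
  open import Data.Product using (∃-syntax)
  open import Function using (_∘_)

  shifts⇒uniform : ∀ f K .{{_ : NonZero K}} →
    (∀ j n → ∃[ t ] f (n + + (K ℕ.* 2 ^ j)) ≡ f n + (+ 1 + + 2 * t) * + (2 ^ j)) →
    ∀ j → UniformMod2^ f j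
  shifts⇒uniform f K shift j r = bounded-discrepancy⇒converges (λ N → countRes f M r N) M (P ℕ.* M) bound
    where
    M = 2 ^ j
    P = K ℕ.* M
    instance
      M≢0 : NonZero M
      M≢0 = ℕ.m^n≢0 2 j
      P≢0 : NonZero P
      P≢0 = ℕ.m*n≢0 K M
    bound : ∀ N → ∣ countRes f M r N ℕ.* M ⊖ suc (2 ℕ.* N) ∣ ≤ P ℕ.* M
    bound N = subst (λ c → ∣ c ℕ.* M ⊖ suc (2 ℕ.* N) ∣ ≤ P ℕ.* M) (sym (countRes≡∑ f M r N))
      (discrepancy-≤-period g (λ k → hit≤1 M r (f (+ k - + N))) blocks refl (suc (2 ℕ.* N)))
      where
      g : ℕ → ℕ
      g k = hit M r (f (+ k - + N))
      [a+k]-N≡[a-N]+k : ∀ a k → + (a ℕ.+ k) - + N ≡ (+ a - + N) + + k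
      [a+k]-N≡[a-N]+k a k = trans (cong (_- + N) (pos-+ a k)) (shuffle (+ a) (+ k) (+ N))
        where
        shuffle : ∀ a k n → a + k - n ≡ (a - n) + k
        shuffle = solve-∀
      blocks : ∀ a → ∑[ k < P ] g (a ℕ.+ k) ≡ K
      blocks a = trans (∑-cong P (λ k → cong (hit M r ∘ f) ([a+k]-N≡[a-N]+k a k)))
                       (shifts⇒balanced f K shift j r (+ a - + N))

open Equidistribution

module Theta where
  open import Data.Nat as ℕ using (_^_)
  import Data.Nat.Properties as ℕ
  open import Data.Integer using (+_; _+_; _-_; _*_; _/_; _%ℕ_; _/ℕ_)
  open import Data.Integer.Properties using (*-cancelʳ-≡; *-distribʳ-+; +-identityˡ; pos-*)
  open import Data.Integer.DivMod using (a≡a%ℕn+[a/ℕn]*n; div-pos-is-/ℕ)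
  open import Data.Integer.Divisibility.Signed using (_∣_; divides)
  open import Data.Integer.Tactic.RingSolver using (solve-∀)
  open import Data.Product using (_,_)
  open import Data.Sum using (inj₁; inj₂)
  open import Function using (_∘_)

  n[n-1]/2*2 : ∀ n → (n * (n - + 1)) / + 2 * + 2 ≡ n * (n - + 1)
  n[n-1]/2*2 n = begin
    x / + 2 * + 2                  ≡⟨ cong (_* + 2) (div-pos-is-/ℕ x 2) ⟩
    x /ℕ 2 * + 2                   ≡⟨ +-identityˡ (x /ℕ 2 * + 2) ⟨
    + 0 + x /ℕ 2 * + 2             ≡⟨ cong (λ ρ → + ρ + x /ℕ 2 * + 2) x%2≡0 ⟨
    + (x %ℕ 2) + x /ℕ 2 * + 2      ≡⟨ a≡a%ℕn+[a/ℕn]*n x 2 ⟨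
    x                              ∎
    where
    open ≡-Reasoning
    x = n * (n - + 1)
    2∣x : + 2 ∣ x - + 0
    2∣x with parity n
    ... | u , inj₁ n≡2u   = divides (u * (+ 2 * u - + 1)) (trans (cong (λ n → n * (n - + 1) - + 0) n≡2u) (even u))
      where
      even : ∀ u → + 2 * u * (+ 2 * u - + 1) - + 0 ≡ u * (+ 2 * u - + 1) * + 2
      even = solve-∀
    ... | u , inj₂ n≡1+2u = divides ((+ 1 + + 2 * u) * u) (trans (cong (λ n → n * (n - + 1) - + 0) n≡1+2u) (odd u))
      where
      odd : ∀ u → (+ 1 + + 2 * u) * ((+ 1 + + 2 * u) - + 1) - + 0 ≡ (+ 1 + + 2 * u) * u * + 2
      odd = solve-∀
    x%2≡0 : x %ℕ 2 ≡ 0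
    x%2≡0 = ∣⇒%ℕ-≡ 2 x (+ 0) 2∣x

  θ*2 : ∀ c₁ c₂ n → θ c₁ c₂ n * + 2 ≡ c₁ * n * + 2 + c₂ * (n * (n - + 1))
  θ*2 c₁ c₂ n = trans (distrib c₁ c₂ n (n * (n - + 1) / + 2)) (cong (λ T → c₁ * n * + 2 + c₂ * T) (n[n-1]/2*2 n))
    where
    distrib : ∀ c₁ c₂ n T → (c₁ * n + c₂ * T) * + 2 ≡ c₁ * n * + 2 + c₂ * (T * + 2)
    distrib = solve-∀

  -- θ involves a division by 2, so the increment o is specified after doubling.
  θ-shift : ∀ c₁ c₂ n p o → c₁ * p * + 2 + c₂ * (p * (+ 2 * n + p - + 1)) ≡ o * + 2 →
    θ c₁ c₂ (n + p) ≡ θ c₁ c₂ n + o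
  θ-shift c₁ c₂ n p o increment = *-cancelʳ-≡ _ _ (+ 2) (begin
    θ c₁ c₂ (n + p) * + 2                                                             ≡⟨ θ*2 c₁ c₂ (n + p) ⟩
    c₁ * (n + p) * + 2 + c₂ * ((n + p) * (n + p - + 1))                               ≡⟨ expand c₁ c₂ n p ⟩
    (c₁ * n * + 2 + c₂ * (n * (n - + 1))) + (c₁ * p * + 2 + c₂ * (p * (+ 2 * n + p - + 1))) ≡⟨ cong₂ _+_ (θ*2 c₁ c₂ n) (sym increment) ⟨
    θ c₁ c₂ n * + 2 + o * + 2                                                         ≡⟨ *-distribʳ-+ (+ 2) (θ c₁ c₂ n) o ⟨
    (θ c₁ c₂ n + o) * + 2                                                             ∎)
    where
    open ≡-Reasoning
    expand : ∀ c₁ c₂ n p → c₁ * (n + p) * + 2 + c₂ * ((n + p) * (n + p - + 1))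
      ≡ (c₁ * n * + 2 + c₂ * (n * (n - + 1))) + (c₁ * p * + 2 + c₂ * (p * (+ 2 * n + p - + 1)))
    expand = solve-∀

  θ-shift-4∣c₂ : ∀ a k n p → θ (+ 1 + + 2 * a) (+ 4 * k) (n + p)
    ≡ θ (+ 1 + + 2 * a) (+ 4 * k) n + (+ 1 + + 2 * (a + k * (+ 2 * n + p - + 1))) * p
  θ-shift-4∣c₂ a k n p = θ-shift (+ 1 + + 2 * a) (+ 4 * k) n p _ (increment a k n p)
    where
    increment : ∀ a k n p → (+ 1 + + 2 * a) * p * + 2 + (+ 4 * k) * (p * (+ 2 * n + p - + 1))
      ≡ (+ 1 + + 2 * (a + k * (+ 2 * n + p - + 1))) * p * + 2
    increment = solve-∀

  θ-shift-c₂-odd : ∀ c₁ b n p → θ c₁ (+ 1 + + 2 * b) (n + + 2 * p)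
    ≡ θ c₁ (+ 1 + + 2 * b) n + (+ 1 + + 2 * (c₁ + n + p - + 1 + b * (+ 2 * n + + 2 * p - + 1))) * p
  θ-shift-c₂-odd c₁ b n p = θ-shift c₁ (+ 1 + + 2 * b) n (+ 2 * p) _ (increment c₁ b n p)
    where
    increment : ∀ c₁ b n p → c₁ * (+ 2 * p) * + 2 + (+ 1 + + 2 * b) * ((+ 2 * p) * (+ 2 * n + + 2 * p - + 1))
      ≡ (+ 1 + + 2 * (c₁ + n + p - + 1 + b * (+ 2 * n + + 2 * p - + 1))) * p * + 2
    increment = solve-∀

  θ-even : ∀ a q u → θ (+ 1 + + 2 * a) (+ 2 + + 4 * q) (+ 2 * u) ≡ u * (a + u + + 2 * q * u - q) * + 4
  θ-even a q u = *-cancelʳ-≡ _ _ (+ 2) (trans (θ*2 (+ 1 + + 2 * a) (+ 2 + + 4 * q) (+ 2 * u)) (expand a q u))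
    where
    expand : ∀ a q u → (+ 1 + + 2 * a) * (+ 2 * u) * + 2 + (+ 2 + + 4 * q) * (+ 2 * u * (+ 2 * u - + 1))
      ≡ u * (a + u + + 2 * q * u - q) * + 4 * + 2
    expand = solve-∀

  θ-uniform-4∣c₂ : ∀ a k j → UniformMod2^ (θ (+ 1 + + 2 * a) (+ 4 * k)) j
  θ-uniform-4∣c₂ a k = shifts⇒uniform f 1 λ j n →
    a + k * (+ 2 * n + + (2 ^ j) - + 1) ,
    trans (cong (f ∘ _+_ n ∘ +_) (ℕ.*-identityˡ (2 ^ j))) (θ-shift-4∣c₂ a k n (+ (2 ^ j)))
    where
    f = θ (+ 1 + + 2 * a) (+ 4 * k)

  θ-uniform-c₂-odd : ∀ c₁ b j → UniformMod2^ (θ c₁ (+ 1 + + 2 * b)) j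
  θ-uniform-c₂-odd c₁ b = shifts⇒uniform f 2 λ j n →
    c₁ + n + + (2 ^ j) - + 1 + b * (+ 2 * n + + 2 * + (2 ^ j) - + 1) ,
    trans (cong (f ∘ _+_ n) (pos-* 2 (2 ^ j))) (θ-shift-c₂-odd c₁ b n (+ (2 ^ j)))
    where
    f = θ c₁ (+ 1 + + 2 * b)

open Theta

module Classification where
  open import Data.Nat as ℕ using (ℕ; suc; _≤_; _<_)
  import Data.Nat.Properties as ℕ
  import Data.Nat.Tactic.RingSolver as ℕ-Solver
  open import Data.Nat.Coprimality using (1-coprimeTo)
  open import Data.Integer using (ℤ; +_; _+_; _-_; _*_; _⊖_; ∣_∣; +<+)
  open import Data.Integer.Properties using (⊖-≥; pos-+)
  open import Data.Integer.Divisibility.Signed using (divides)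
  open import Data.Integer.Tactic.RingSolver using (solve-∀)
  open import Data.Rational as ℚ using (ℚ; mkℚ)
  open import Data.Product using (∃-syntax; _,_; proj₁; proj₂)
  open import Data.Sum using (_⊎_; inj₁; inj₂)
  open import Function using (_∘_; Equivalence)
  open import Relation.Nullary using (¬_)

  window-count≥N : ∀ (h : ℤ → ℕ) → (∀ x → 1 ≤ h x ℕ.+ h (x + + 1)) → ∀ N → N ≤ ∑[ k < suc (2 ℕ.* N) ] h (+ k - + N)
  window-count≥N h consecutive N = begin
    N                                 ≤⟨ ∑-pairs-≥ N (g ∘ suc) shifted-consecutive ⟩
    ∑ (N ℕ.+ N) (g ∘ suc)             ≡⟨ cong (λ n → ∑ (N ℕ.+ n) (g ∘ suc)) (ℕ.+-identityʳ N) ⟨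
    ∑ (2 ℕ.* N) (g ∘ suc)             ≤⟨ ℕ.m≤n+m _ (g 0) ⟩
    ∑ (suc (2 ℕ.* N)) g               ∎
    where
    open ℕ.≤-Reasoning
    g : ℕ → ℕ
    g k = h (+ k - + N)
    next : ∀ k → (+ suc k - + N) + + 1 ≡ + suc (suc k) - + N
    next k = trans (shuffle (+ suc k) (+ N)) (cong (_- + N) (sym (pos-+ 1 (suc k))))
      where
      shuffle : ∀ k n → (k - n) + + 1 ≡ (+ 1 + k) - n
      shuffle = solve-∀
    shifted-consecutive : ∀ k → 1 ≤ g (suc k) ℕ.+ g (suc (suc k))
    shifted-consecutive k = subst (λ y → 1 ≤ g (suc k) ℕ.+ h y) (next k) (consecutive (+ suc k - + N))

  quarter-gap : ∀ n c → suc n ≤ c → ¬ (∣ c ℕ.* 4 ⊖ suc (2 ℕ.* suc n) ∣ ℕ.* 12 < 1 ℕ.* (suc (2 ℕ.* suc n) ℕ.* 4))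
  quarter-gap n c n<c gap = ℕ.<⇒≱ gap (begin
    1 ℕ.* (L ℕ.* 4)                              ≡⟨ ℕ.*-identityˡ (L ℕ.* 4) ⟩
    L ℕ.* 4                                      ≤⟨ ℕ.m≤m+n (L ℕ.* 4) (16 ℕ.* n ℕ.+ 48 ℕ.* e) ⟩
    L ℕ.* 4 ℕ.+ (16 ℕ.* n ℕ.+ 48 ℕ.* e)          ≡⟨ excess*12 n e ⟨
    x ℕ.* 12                                     ≡⟨ cong (ℕ._* 12) ∣c*4⊖L∣≡x ⟨
    ∣ c ℕ.* 4 ⊖ L ∣ ℕ.* 12                       ∎)
    where
    open ℕ.≤-Reasoning
    L = suc (2 ℕ.* suc n)
    e = c ℕ.∸ suc n
    x = 2 ℕ.* n ℕ.+ 1 ℕ.+ 4 ℕ.* e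
    c*4≡L+x : c ℕ.* 4 ≡ L ℕ.+ x
    c*4≡L+x = trans (cong (ℕ._* 4) (sym (ℕ.m+[n∸m]≡n n<c))) (expand n e)
      where
      expand : ∀ n e → (1 ℕ.+ n ℕ.+ e) ℕ.* 4 ≡ (1 ℕ.+ 2 ℕ.* (1 ℕ.+ n)) ℕ.+ (2 ℕ.* n ℕ.+ 1 ℕ.+ 4 ℕ.* e)
      expand = ℕ-Solver.solve-∀
    ∣c*4⊖L∣≡x : ∣ c ℕ.* 4 ⊖ L ∣ ≡ x
    ∣c*4⊖L∣≡x = begin-equality
      ∣ c ℕ.* 4 ⊖ L ∣        ≡⟨ cong (∣_∣ ∘ (_⊖ L)) c*4≡L+x ⟩
      ∣ (L ℕ.+ x) ⊖ L ∣      ≡⟨ cong ∣_∣ (⊖-≥ (ℕ.m≤m+n L x)) ⟩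
      L ℕ.+ x ℕ.∸ L          ≡⟨ ℕ.m+n∸m≡n L x ⟩
      x                      ∎
    excess*12 : ∀ n e → (2 ℕ.* n ℕ.+ 1 ℕ.+ 4 ℕ.* e) ℕ.* 12 ≡ (1 ℕ.+ 2 ℕ.* (1 ℕ.+ n)) ℕ.* 4 ℕ.+ (16 ℕ.* n ℕ.+ 48 ℕ.* e)
    excess*12 = ℕ-Solver.solve-∀

  module _ (a q : ℤ) where
    private
      f : ℤ → ℤ
      f = θ (+ 1 + + 2 * a) (+ 2 + + 4 * q)

    hit-θ-even : ∀ u → hit 4 (+ 0) (f (+ 2 * u)) ≡ 1
    hit-θ-even u = hit≡1 4 (+ 0) (f (+ 2 * u))
      (divides (u * (a + u + + 2 * q * u - q)) (trans (x-0≡x (f (+ 2 * u))) (θ-even a q u)))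
      where
      x-0≡x : ∀ x → x - + 0 ≡ x
      x-0≡x = solve-∀

    θ-consecutive-hit : ∀ x → 1 ≤ hit 4 (+ 0) (f x) ℕ.+ hit 4 (+ 0) (f (x + + 1))
    θ-consecutive-hit x with parity x
    ... | u , inj₁ refl = subst (λ h → 1 ≤ h ℕ.+ hit 4 (+ 0) (f (+ 2 * u + + 1))) (sym (hit-θ-even u)) (ℕ.m≤m+n 1 _)
    ... | u , inj₂ refl = subst (λ h → 1 ≤ hit 4 (+ 0) (f (+ 1 + + 2 * u)) ℕ.+ h) (sym next-is-even) (ℕ.m≤n+m 1 _)
      where
      succ : ∀ u → + 1 + + 2 * u + + 1 ≡ + 2 * (u + + 1)
      succ = solve-∀
      next-is-even : hit 4 (+ 0) (f (+ 1 + + 2 * u + + 1)) ≡ 1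
      next-is-even = trans (cong (hit 4 (+ 0) ∘ f) (succ u)) (hit-θ-even (u + + 1))

    not-uniform-mod-4 : ¬ UniformMod2^ f 2
    not-uniform-mod-4 uniform = quarter-gap N₀ c N≤c
      (Equivalence.to (∣c/L-1/M∣<ε⇔ c (2 ℕ.* N) 4 0 11 (1-coprimeTo 12)) (close N (ℕ.n≤1+n N₀)))
      where
      -- For N ≥ 1 the count c satisfies c / (2N+1) ≥ N / (2N+1) ≥ 1/3 = 1/4 + 1/12.
      1/12 : ℚ
      1/12 = mkℚ (+ 1) 11 (1-coprimeTo 12)
      converging = uniform (+ 0) 1/12 (ℚ.*<* (+<+ (ℕ.s≤s ℕ.z≤n)))
      N₀ = proj₁ converging
      close = proj₂ converging
      N = suc N₀
      c = countRes f 4 (+ 0) N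
      N≤c : N ≤ c
      N≤c = subst (N ≤_) (sym (countRes≡∑ f 4 (+ 0) N)) (window-count≥N (hit 4 (+ 0) ∘ f) θ-consecutive-hit N)

  uniform⇒c₂≢2 : ∀ c₁ c₂ → gcd c₁ c₂ ≡ + 1 → (∀ j → UniformMod2^ (θ c₁ c₂) j) → c₂ %ℕ 4 ≢ 2
  uniform⇒c₂≢2 c₁ c₂ gcd≡1 uniform c₂%4≡2 =
    let q , c₂≡2+4q = c%ℕ4≡2⇒c≡2+4q c₂ c₂%4≡2
        a , c₁≡1+2a = gcd≡1∧2∣c₂⇒c₁-odd c₁ c₂ gcd≡1 (divides (+ 1 + + 2 * q) (trans c₂≡2+4q (twice-odd q)))
    in not-uniform-mod-4 a q (subst₂ (λ c₁ c₂ → UniformMod2^ (θ c₁ c₂) 2) c₁≡1+2a c₂≡2+4q (uniform 2))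
    where
    twice-odd : ∀ q → + 2 + + 4 * q ≡ (+ 1 + + 2 * q) * + 2
    twice-odd = solve-∀

  c₂≢2⇒uniform : ∀ c₁ c₂ → gcd c₁ c₂ ≡ + 1 → c₂ %ℕ 4 ≢ 2 → ∀ j → UniformMod2^ (θ c₁ c₂) j
  c₂≢2⇒uniform c₁ c₂ gcd≡1 c₂%4≢2 = by-cases (c%ℕ4≢2⇒c≡4k⊎c≡1+2b c₂ c₂%4≢2)
    where
    Uniform : ℤ → ℤ → Set
    Uniform c₁ c₂ = ∀ j → UniformMod2^ (θ c₁ c₂) j
    twice-even : ∀ k → + 4 * k ≡ + 2 * k * + 2
    twice-even = solve-∀
    by-cases : (∃[ k ] c₂ ≡ + 4 * k) ⊎ (∃[ b ] c₂ ≡ + 1 + + 2 * b) → Uniform c₁ c₂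
    by-cases (inj₁ (k , c₂≡4k)) =
      let a , c₁≡1+2a = gcd≡1∧2∣c₂⇒c₁-odd c₁ c₂ gcd≡1 (divides (+ 2 * k) (trans c₂≡4k (twice-even k)))
      in subst₂ Uniform (sym c₁≡1+2a) (sym c₂≡4k) (θ-uniform-4∣c₂ a k)
    by-cases (inj₂ (b , c₂≡1+2b)) = subst (Uniform c₁) (sym c₂≡1+2b) (θ-uniform-c₂-odd c₁ b)

open Classification

proposition6p1 : (c₁ c₂ : ℤ) → gcd c₁ c₂ ≡ + 1 →
    ((∀ (j : ℕ) → UniformMod2^ (θ c₁ c₂) j) → c₂ %ℕ 4 ≢ 2) ×
    (c₂ %ℕ 4 ≢ 2 → ∀ (j : ℕ) → UniformMod2^ (θ c₁ c₂) j)
proposition6p1 c₁ c₂ gcd≡1 = uniform⇒c₂≢2 c₁ c₂ gcd≡1 , c₂≢2⇒uniform c₁ c₂ gcd≡1
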